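{- $CAN(3,16,2)\ge 15$; that is, there is no binary $3$-covering array with $14$ rows and $16$ columns (nor with fewer rows).
   Context: A binary $t$-covering array of size $m$ and degree $n$ is an $m\times n$ matrix with entries in $\{0,1\}$ such that for any $t$ distinct columns, all $2^t$ binary vectors of length $t$ occur at least once as the restriction of some row to those columns. $CAN(t,n,2)$ denotes the minimum $m$ such that a binary $t$-covering array of size $m$ and degree $n$ exists. -}

module Defs where

open import Data.Nat using (ℕ)
open import Data.Fin using (Fin)
open import Data.Bool using (Bool)
open import Data.Product using (∃-syntax)
open import Relation.Binary.PropositionalEquality using (_≡_)
open import Function.Definitions using (Injective)

Matrix : ℕ → ℕ → Set
Matrix m n = Fin m → Fin n → Bool

IsCoveringArray : (t m n : ℕ) → Matrix m n → Set
IsCoveringArray t m n A =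
  (c : Fin t → Fin n) → Injective _≡_ _≡_ c →
  (v : Fin t → Bool) → ∃[ r ] ((i : Fin t) → A r (c i) ≡ v i)

module Submission where

-- Padding reduces to 14 rows.  In a CA(14;3,16,2) the rows with a fixed value
-- in a column c form a derived CA(k;2,15,2).  An exhaustive clique search over
-- normalised columns shows every CA(7;2,15,2) is Tight: columns have 3 or 4
-- ones and distinct rows differ in 8 or 10 columns.  Hence CAN(2,15,2) ≥ 7, so
-- each column splits 7 + 7, two columns show every value pair 3 or 4 times,
-- and two distinct rows never agree in exactly 7 columns.  Double counting the
-- agreements a(p,q) gives ∑a = 1568 and ∑a² = 13568, whereas (a − 6)(a − 8) ≥ 0
-- off the diagonal and a(p,p) = 16 force 23072 ≤ 22976.

open import Defs
open import Data.Bool using (Bool; true; false; not; _∧_; _∨_; _xor_; T)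
open import Data.Bool.Properties using (T-∨; T-∧; T-≡; xor-same; xor-identityʳ)
import Data.Bool.Properties as Bool
open import Data.Nat using (ℕ; _≤_; zero; suc; _+_; _*_; _<_; _≤?_; _<ᵇ_; z≤n; s≤s; s≤s⁻¹; _⊓_)
open import Data.Nat.Properties
  using (+-assoc; +-comm; +-identityʳ; *-identityʳ; *-zeroʳ; +-mono-≤; +-monoʳ-≤; +-cancelˡ-≡; +-cancelʳ-≤;
         ≤-refl; ≤-reflexive; ≤-trans; ≤-antisym; <⇒≤; ≰⇒>; ≤⇒≯; <ᵇ⇒<; ≤ᵇ⇒≤; ≤⇒≤ᵇ; m≤m+n;
         m⊓n≤n; m≤n⇒m⊓n≡m; +-commutativeSemigroup; +-*-semiring)
open import Data.Nat.Solver using (module +-*-Solver)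
open import Data.Nat.ListAction renaming (sum to listSum)
open import Data.Nat.ListAction.Properties using (sum-↭)
open import Data.Fin using (Fin; zero; suc; punchIn; toℕ; fromℕ<; inject≤)
open import Data.Fin.Properties
  using (any?; all?; pigeonhole; punchInᵢ≢i; punchIn-injective; toℕ-fromℕ<; toℕ-inject≤; toℕ<n;
         toℕ-injective; inject≤-injective)
import Data.Fin.Properties as Fin
open import Data.List using (List; []; _∷_; length; _++_; filter; map; tabulate; allFin; lookup)
open import Data.List.Properties using (++-assoc; ++-identityʳ; length-++; length-tabulate; filter-all)
open import Data.List.Relation.Unary.Any using (here; there; index)
open import Data.List.Relation.Unary.Any.Properties using (lookup-index)
open import Data.List.Relation.Unary.All as All using (All; []; _∷_)
open import Data.List.Relation.Unary.All.Properties using (all-filter)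
open import Data.List.Relation.Unary.AllPairs using (AllPairs; []; _∷_)
open import Data.List.Relation.Unary.Unique.Propositional using (Unique)
import Data.List.Relation.Unary.Unique.Propositional.Properties as Unique
open import Data.List.Relation.Binary.Sublist.Propositional using (_⊆_; []; _∷_; _∷ʳ_)
open import Data.List.Relation.Binary.Sublist.Propositional.Properties using (length-mono-≤; filter⁺; filter-⊆)
open import Data.List.Relation.Binary.Permutation.Propositional using (_↭_)
import Data.List.Relation.Binary.Permutation.Propositional.Properties as Perm
open import Data.List.Relation.Binary.BagAndSetEquality using (∼bag⇒↭)
open import Data.List.Membership.Propositional using (_∈_)
open import Data.List.Membership.Propositional.Properties
  using (∈-map⁺; ∈-++⁺ˡ; ∈-++⁺ʳ; ∈-filter⁺; ∈-filter⁻; ∈-tabulate⁺; ∈-tabulate⁻; ∈-allFin)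
open import Data.List.Membership.Propositional.Properties.WithK using (unique∧set⇒bag)
open import Data.List.Membership.DecPropositional Data.Nat._≟_ using (_∈?_)
open import Data.Vec as Vec using (Vec; []; _∷_)
open import Data.Vec.Properties using (lookup∘tabulate; ≡-dec)
open import Data.List.Relation.Unary.Unique.DecPropositional (≡-dec {n = 7} Bool._≟_) using (unique?)
import Data.Vec.Functional as Vector
open import Data.Product using (∃; _×_; _,_; proj₁; proj₂)
open import Data.Sum using (inj₁; inj₂)
open import Data.Empty using (⊥; ⊥-elim)
open import Function using (_∘_; Equivalence; mk⇔)
open import Function.Definitions using (Injective)
open import Relation.Unary using (Decidable)
open import Relation.Nullary using (¬_; Dec; yes; no; does; isYes; ¬?; _×-dec_; _→-dec_)
open import Relation.Nullary.Decidable using (toWitness; dec-true; dec-false)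
open import Relation.Nullary.Decidable.Core using (T?)
open import Relation.Binary.PropositionalEquality
  using (_≡_; _≢_; refl; sym; trans; cong; cong₂; subst; subst₂; module ≡-Reasoning)
open import Algebra.Properties.CommutativeSemigroup +-commutativeSemigroup using (interchange)
open import Algebra.Properties.Semiring.Sum +-*-semiring
  using (sum; sum-syntax; sum-cong-≗; sum-remove; *-distribˡ-sum; *-distribʳ-sum)

χ : Bool → ℕ
χ true = 1
χ false = 0

∑-+ : ∀ {n} (f g : Fin n → ℕ) → ∑[ i < n ] (f i + g i) ≡ sum f + sum g
∑-+ {zero} f g = refl
∑-+ {suc n} f g = trans (cong (f zero + g zero +_) (∑-+ (f ∘ suc) (g ∘ suc)))
                        (interchange (f zero) (g zero) (sum (f ∘ suc)) (sum (g ∘ suc)))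

∑-const : ∀ n k → ∑[ i < n ] k ≡ n * k
∑-const zero k = refl
∑-const (suc n) k = cong (k +_) (∑-const n k)

∑-swap : ∀ {m n} (f : Fin m → Fin n → ℕ) → ∑[ i < m ] ∑[ j < n ] f i j ≡ ∑[ j < n ] ∑[ i < m ] f i j
∑-swap {zero} {n} f = sym (trans (∑-const n 0) (*-zeroʳ n))
∑-swap {suc m} f = trans (cong (sum (f zero) +_) (∑-swap (f ∘ suc)))
                         (sym (∑-+ (f zero) (λ j → ∑[ i < m ] f (suc i) j)))

∑-mono : ∀ {n} {f g : Fin n → ℕ} → (∀ i → f i ≤ g i) → sum f ≤ sum g
∑-mono {zero} le = z≤n
∑-mono {suc n} le = +-mono-≤ (le zero) (∑-mono (le ∘ suc))

∑-square : ∀ {n} (f : Fin n → ℕ) → sum f * sum f ≡ ∑[ i < n ] ∑[ j < n ] (f i * f j)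
∑-square f = trans (*-distribʳ-sum (sum f) f) (sum-cong-≗ λ i → *-distribˡ-sum (f i) f)

count-complement : ∀ {n} (P : Fin n → Bool) → ∑[ i < n ] χ (P i) + ∑[ i < n ] χ (not (P i)) ≡ n
count-complement {n} P = begin
  ∑[ i < n ] χ (P i) + ∑[ i < n ] χ (not (P i)) ≡⟨ sym (∑-+ (χ ∘ P) (χ ∘ not ∘ P)) ⟩
  ∑[ i < n ] (χ (P i) + χ (not (P i)))          ≡⟨ sum-cong-≗ (λ i → one (P i)) ⟩
  ∑[ i < n ] 1                                  ≡⟨ trans (∑-const n 1) (*-identityʳ n) ⟩
  n ∎
  where
  open ≡-Reasoning
  one : ∀ b → χ b + χ (not b) ≡ 1
  one true = refl
  one false = refl

count-witness : ∀ {n} (P : Fin n → Bool) → 0 < ∑[ i < n ] χ (P i) → ∃ λ i → T (P i)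
count-witness {suc n} P pos with P zero in eq
... | true = zero , subst T (sym eq) _
... | false = let (i , Pi) = count-witness (P ∘ suc) pos in suc i , Pi

listSum-tabulate : ∀ {A : Set} {n} (g : A → ℕ) (f : Fin n → A) → listSum (map g (tabulate f)) ≡ ∑[ i < n ] g (f i)
listSum-tabulate {n = zero} g f = refl
listSum-tabulate {n = suc n} g f = cong (g (f zero) +_) (listSum-tabulate g (f ∘ suc))

∑∑-+ : ∀ {n} (f g : Fin n → Fin n → ℕ) →
       ∑[ p < n ] ∑[ q < n ] (f p q + g p q) ≡ ∑[ p < n ] ∑[ q < n ] f p q + ∑[ p < n ] ∑[ q < n ] g p q
∑∑-+ f g = trans (sum-cong-≗ λ p → ∑-+ (f p) (g p)) (∑-+ (λ p → sum (f p)) (λ p → sum (g p)))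

∑∑-* : ∀ {n} k (f : Fin n → Fin n → ℕ) → ∑[ p < n ] ∑[ q < n ] (k * f p q) ≡ k * ∑[ p < n ] ∑[ q < n ] f p q
∑∑-* k f = trans (sum-cong-≗ λ p → sym (*-distribˡ-sum k (f p))) (sym (*-distribˡ-sum k (λ p → sum (f p))))

∑∑∑-swap : ∀ {m n} (F : Fin m → Fin m → Fin n → ℕ) →
           ∑[ p < m ] ∑[ q < m ] ∑[ c < n ] F p q c ≡ ∑[ c < n ] ∑[ p < m ] ∑[ q < m ] F p q c
∑∑∑-swap F = trans (sum-cong-≗ λ p → ∑-swap (F p)) (∑-swap (λ p c → ∑[ q < _ ] F p q c))

∑∑∑∑-swap : ∀ {m n} (F : Fin m → Fin m → Fin n → Fin n → ℕ) →
            ∑[ p < m ] ∑[ q < m ] ∑[ c < n ] ∑[ d < n ] F p q c d ≡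
            ∑[ c < n ] ∑[ d < n ] ∑[ p < m ] ∑[ q < m ] F p q c d
∑∑∑∑-swap F = trans (∑∑∑-swap (λ p q c → ∑[ d < _ ] F p q c d))
                    (sum-cong-≗ λ c → ∑∑∑-swap (λ p q d → F p q c d))

∑𝔹 : (Bool → ℕ) → ℕ
∑𝔹 f = f true + f false

pairs-by-value : ∀ {n} (w : Fin n → Bool → ℕ) →
                 ∑[ p < n ] ∑[ q < n ] ∑𝔹 (λ x → w p x * w q x) ≡
                 ∑𝔹 (λ x → sum (λ p → w p x) * sum (λ p → w p x))
pairs-by-value w = trans (∑∑-+ (λ p q → w p true * w q true) (λ p q → w p false * w q false))
                         (sym (cong₂ _+_ (∑-square (λ p → w p true)) (∑-square (λ p → w p false))))

pairs-by-value² : ∀ {n} (w : Fin n → Bool → Bool → ℕ) →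
                  ∑[ p < n ] ∑[ q < n ] ∑𝔹 (λ x → ∑𝔹 λ y → w p x y * w q x y) ≡
                  ∑𝔹 (λ x → ∑𝔹 λ y → sum (λ p → w p x y) * sum (λ p → w p x y))
pairs-by-value² w =
  trans (∑∑-+ (λ p q → ∑𝔹 λ y → w p true y * w q true y) (λ p q → ∑𝔹 λ y → w p false y * w q false y))
        (cong₂ _+_ (pairs-by-value (λ p → w p true)) (pairs-by-value (λ p → w p false)))

filter-sum : ∀ {A : Set} {P : A → Set} (P? : Decidable P) (f : A → ℕ) xs →
             ∑[ i < length (filter P? xs) ] f (lookup (filter P? xs) i) ≡
             listSum (map (λ x → χ (does (P? x)) * f x) xs)
filter-sum P? f [] = refl
filter-sum P? f (x ∷ xs) with does (P? x)
... | true = cong₂ _+_ (sym (+-identityʳ (f x))) (filter-sum P? f xs)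
... | false = filter-sum P? f xs

module _ {m} {P : Fin m → Set} (P? : Decidable P) where

  members : List (Fin m)
  members = filter P? (allFin m)

  member : Fin (length members) → Fin m
  member = lookup members

  member-complete : ∀ r → P r → ∃ λ i → member i ≡ r
  member-complete r pr = index r∈ , sym (lookup-index r∈)
    where r∈ = ∈-filter⁺ P? (∈-allFin r) pr

  members-sum : ∀ (f : Fin m → ℕ) → ∑[ i < length members ] f (member i) ≡ ∑[ r < m ] (χ (does (P? r)) * f r)
  members-sum f = trans (filter-sum P? f (allFin m)) (listSum-tabulate (λ r → χ (does (P? r)) * f r) (λ r → r))

  members-count : length members ≡ ∑[ r < m ] χ (does (P? r))
  members-count = begin
    length members                    ≡⟨ sym (trans (∑-const (length members) 1) (*-identityʳ _)) ⟩
    ∑[ i < length members ] 1         ≡⟨ members-sum (λ _ → 1) ⟩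
    ∑[ r < m ] (χ (does (P? r)) * 1)  ≡⟨ sum-cong-≗ (λ r → *-identityʳ (χ (does (P? r)))) ⟩
    ∑[ r < m ] χ (does (P? r)) ∎
    where open ≡-Reasoning

agree : Bool → Bool → Bool
agree x y = does (x Bool.≟ y)

agree-sound : ∀ {x y} → T (agree x y) → x ≡ y
agree-sound {true} {true} _ = refl
agree-sound {false} {false} _ = refl

agree≡not-xor : ∀ x y → agree x y ≡ not (x xor y)
agree≡not-xor true true = refl
agree≡not-xor true false = refl
agree≡not-xor false true = refl
agree≡not-xor false false = refl

agree-by-value : ∀ a a′ → χ (agree a a′) ≡ ∑𝔹 λ x → χ (agree a x) * χ (agree a′ x)
agree-by-value true true = refl
agree-by-value true false = refl
agree-by-value false true = refl
agree-by-value false false = refl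

agree²-by-value : ∀ a b a′ b′ → χ (agree a a′) * χ (agree b b′) ≡
                  ∑𝔹 λ x → ∑𝔹 λ y → (χ (agree a x) * χ (agree b y)) * (χ (agree a′ x) * χ (agree b′ y))
agree²-by-value true true true true = refl
agree²-by-value true true true false = refl
agree²-by-value true true false true = refl
agree²-by-value true true false false = refl
agree²-by-value true false true true = refl
agree²-by-value true false true false = refl
agree²-by-value true false false true = refl
agree²-by-value true false false false = refl
agree²-by-value false true true true = refl
agree²-by-value false true true false = refl
agree²-by-value false true false true = refl
agree²-by-value false true false false = refl
agree²-by-value false false true true = refl
agree²-by-value false false true false = refl
agree²-by-value false false false true = refl
agree²-by-value false false false false = refl

xor-cancelʳ : ∀ x h → (x xor h) xor h ≡ x
xor-cancelʳ false false = refl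
xor-cancelʳ false true = refl
xor-cancelʳ true false = refl
xor-cancelʳ true true = refl

xor-cancel-both : ∀ x y h → (x xor h) xor (y xor h) ≡ x xor y
xor-cancel-both x y h = trans (cong₂ _xor_ (Bool.xor-comm x h) (Bool.xor-comm y h)) (complement-first h)
  where
  complement-first : ∀ h → (h xor x) xor (h xor y) ≡ x xor y
  complement-first false = refl
  complement-first true = Bool.xor-annihilates-not x y

weight : ∀ {m n} → Matrix m n → Fin n → ℕ
weight {m} M d = ∑[ i < m ] χ (M i d)

distance : ∀ {m n} → Matrix m n → Fin m → Fin m → ℕ
distance {n = n} M i j = ∑[ d < n ] χ (M i d xor M j d)

reindex-rows : ∀ {t k k′ n} (A : Matrix k n) (s : Fin k′ → Fin k) → (∀ r → ∃ λ i → s i ≡ r) →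
               IsCoveringArray t k n A → IsCoveringArray t k′ n (λ i → A (s i))
reindex-rows A s onto ca c inj v with ca c inj v
... | r , covered with onto r
... | i , refl = i , covered

some-row : ∀ {t m n} (A : Matrix m n) → t ≤ n → IsCoveringArray t m n A → Fin m
some-row A t≤n ca = proj₁ (ca (λ i → inject≤ i t≤n) (inject≤-injective t≤n t≤n _ _) (λ _ → false))

clamp : ∀ {k′} j → Fin k′ → Fin (suc j)
clamp j r = fromℕ< (s≤s (m⊓n≤n (toℕ r) j))

clamp-onto : ∀ {j k′} → suc j ≤ k′ → ∀ r → ∃ λ i → clamp {k′} j i ≡ r
clamp-onto {j} le r = inject≤ r le , toℕ-injective (begin
  toℕ (clamp j (inject≤ r le))  ≡⟨ toℕ-fromℕ< _ ⟩
  toℕ (inject≤ r le) ⊓ j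
    ≡⟨ m≤n⇒m⊓n≡m (≤-trans (≤-reflexive (toℕ-inject≤ r le)) (s≤s⁻¹ (toℕ<n r))) ⟩
  toℕ (inject≤ r le)             ≡⟨ toℕ-inject≤ r le ⟩
  toℕ r ∎)
  where open ≡-Reasoning

pad : ∀ {t k k′ n} (A : Matrix k n) → t ≤ n → k ≤ k′ → IsCoveringArray t k n A →
      ∃ λ (s : Fin k′ → Fin k) → IsCoveringArray t k′ n (λ i → A (s i))
pad {k = zero} A t≤n k≤k′ ca with () ← some-row A t≤n ca
pad {k = suc j} A t≤n k≤k′ ca = clamp j , reindex-rows A (clamp j) (clamp-onto k≤k′) ca

derived : ∀ {t m n k} (A : Matrix m (suc n)) (c : Fin (suc n)) (b : Bool) (e : Fin k → Fin m) →
          (∀ r → A r c ≡ b → ∃ λ i → e i ≡ r) →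
          IsCoveringArray (suc t) m (suc n) A → IsCoveringArray t k n (λ i d → A (e i) (punchIn c d))
derived A c b e reach ca cols inj v with ca (c Vector.∷ punchIn c ∘ cols) with-c (b Vector.∷ v)
  where
  with-c : Injective _≡_ _≡_ (c Vector.∷ punchIn c ∘ cols)
  with-c {zero} {zero} _ = refl
  with-c {zero} {suc j} eq = ⊥-elim (punchInᵢ≢i c (cols j) (sym eq))
  with-c {suc i} {zero} eq = ⊥-elim (punchInᵢ≢i c (cols i) eq)
  with-c {suc i} {suc j} eq = cong suc (inj (punchIn-injective c _ _ eq))
... | r , covered with reach r (covered zero)
... | i , refl = i , covered ∘ suc

pair : ∀ {A : Set} → A → A → Fin 2 → A
pair a b zero = a
pair a b (suc zero) = b

covered-pair : ∀ {m n} (M : Matrix m n) → IsCoveringArray 2 m n M →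
               ∀ {d₁ d₂} → d₁ ≢ d₂ → ∀ x y → ∃ λ i → M i d₁ ≡ x × M i d₂ ≡ y
covered-pair M ca {d₁} {d₂} d₁≢d₂ x y =
  let (i , covered) = ca (pair d₁ d₂) injective (pair x y) in i , covered zero , covered (suc zero)
  where
  injective : Injective _≡_ _≡_ (pair d₁ d₂)
  injective {zero} {zero} _ = refl
  injective {zero} {suc zero} eq = ⊥-elim (d₁≢d₂ eq)
  injective {suc zero} {zero} eq = ⊥-elim (d₁≢d₂ (sym eq))
  injective {suc zero} {suc zero} _ = refl

record Tight {m n} (M : Matrix m n) : Set where
  field
    column-weight : ∀ d → weight M d ∈ 3 ∷ 4 ∷ []
    row-distance  : ∀ i j → i ≢ j → distance M i j ∈ 8 ∷ 10 ∷ []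

-- Columns of a 7-row array, complemented where necessary to start with false.
Code : Set
Code = Vec Bool 7

occurs : ∀ {n} → Vec Bool n → Vec Bool n → Bool → Bool → Bool
occurs [] [] x y = false
occurs (a ∷ u) (b ∷ v) x y = (not (a xor x) ∧ not (b xor y)) ∨ occurs u v x y

covers : ∀ {n} → Vec Bool n → Vec Bool n → Bool
covers u v = occurs u v true true ∧ occurs u v true false ∧ occurs u v false true ∧ occurs u v false false

Covering : List Code → Set
Covering = AllPairs (λ u v → T (covers u v))

ones : Code → ℕ
ones u = ∑[ i < 7 ] χ (Vec.lookup u i)

distance-in : List Code → Fin 7 → Fin 7 → ℕ
distance-in Y i j = listSum (map (λ u → χ (Vec.lookup u i xor Vec.lookup u j)) Y)

Good : List Code → Set
Good Y = All (λ u → ones u ∈ 3 ∷ 4 ∷ []) Y × (∀ i j → i ≢ j → distance-in Y i j ∈ 8 ∷ 10 ∷ [])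

good? : ∀ Y → Dec (Good Y)
good? Y = All.all? (λ u → ones u ∈? 3 ∷ 4 ∷ []) Y ×-dec
          all? λ i → all? λ j → ¬? (i Fin.≟ j) →-dec (distance-in Y i j ∈? 8 ∷ 10 ∷ [])

-- Exhaustive clique search: `search fuel cands chosen` holds when every
-- extension of `chosen` by a pairwise covering sublist of `cands` to at least
-- 15 codes is Good.  Choosing a code discards the candidates it does not
-- cover; branches that cannot reach 15 codes are cut; `fuel` bounds the depth.
search : ℕ → List Code → List Code → Bool
search _ [] chosen = (length chosen <ᵇ 15) ∨ isYes (good? chosen)
search zero (_ ∷ _) chosen = false
search (suc fuel) (u ∷ cands) chosen =
  (length chosen + length (u ∷ cands) <ᵇ 15) ∨
  (search fuel (filter (T? ∘ covers u) cands) (chosen ++ u ∷ []) ∧ search fuel cands chosen)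

⊆-filter : ∀ {A : Set} {P : A → Set} (P? : Decidable P) {xs ys} → xs ⊆ ys → All P xs → xs ⊆ filter P? ys
⊆-filter P? {xs} {ys} sub all = subst (_⊆ filter P? ys) (filter-all P? all) (filter⁺ P? P? (λ { refl p → p }) sub)

search-sound : ∀ fuel cands chosen → search fuel cands chosen ≡ true →
               ∀ {Y} → Y ⊆ cands → Covering Y → 15 ≤ length chosen + length Y → Good (chosen ++ Y)
search-sound fuel [] chosen ok [] _ big with Equivalence.to T-∨ (Equivalence.from T-≡ ok)
... | inj₁ small = ⊥-elim (≤⇒≯ (subst (15 ≤_) (+-identityʳ _) big) (<ᵇ⇒< _ _ small))
... | inj₂ good = subst Good (sym (++-identityʳ chosen)) (toWitness {a? = good? chosen} good)
search-sound (suc fuel) (u ∷ cands) chosen ok sub pairs big with Equivalence.to T-∨ (Equivalence.from T-≡ ok)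
... | inj₁ small = ⊥-elim (≤⇒≯ (≤-trans big (+-monoʳ-≤ (length chosen) (length-mono-≤ sub))) (<ᵇ⇒< _ _ small))
... | inj₂ both with Equivalence.to T-∧ both | sub | pairs
... | _ , skipped | .u ∷ʳ sub′ | pairs′ = search-sound fuel cands chosen (Equivalence.to T-≡ skipped) sub′ pairs′ big
... | taken , _ | refl ∷ sub′ | u-covers ∷ pairs′ =
  subst Good (++-assoc chosen (u ∷ []) _)
    (search-sound fuel (filter (T? ∘ covers u) cands) (chosen ++ u ∷ []) (Equivalence.to T-≡ taken)
                  (⊆-filter (T? ∘ covers u) sub′ u-covers) pairs′ (subst (15 ≤_) (move-one _) big))
  where
  move-one : ∀ n → length chosen + suc n ≡ length (chosen ++ u ∷ []) + n
  move-one n = trans (sym (+-assoc (length chosen) 1 n)) (cong (_+ n) (sym (length-++ chosen)))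

vecs : ∀ n → List (Vec Bool n)
vecs zero = [] ∷ []
vecs (suc n) = map (false ∷_) (vecs n) ++ map (true ∷_) (vecs n)

∈-vecs : ∀ {n} (u : Vec Bool n) → u ∈ vecs n
∈-vecs [] = here refl
∈-vecs (false ∷ u) = ∈-++⁺ˡ (∈-map⁺ (false ∷_) (∈-vecs u))
∈-vecs {suc n} (true ∷ u) = ∈-++⁺ʳ (map (false ∷_) (vecs n)) (∈-map⁺ (true ∷_) (∈-vecs u))

codes : List Code
codes = map (false ∷_) (vecs 6)

codes-unique : Unique codes
codes-unique = toWitness {a? = unique? codes} _

-- The computation: every pairwise covering set of at least 15 codes is Good.
search-succeeds : search 64 codes [] ≡ true
search-succeeds = refl

occurs-complete : ∀ {n} (u v : Vec Bool n) {x y} i → Vec.lookup u i ≡ x → Vec.lookup v i ≡ y → T (occurs u v x y)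
occurs-complete (a ∷ u) (b ∷ v) zero refl refl = Equivalence.from T-∨ (inj₁ (self-match a b))
  where
  self-match : ∀ a b → T (not (a xor a) ∧ not (b xor b))
  self-match a b rewrite xor-same a | xor-same b = _
occurs-complete (a ∷ u) (b ∷ v) (suc i) eu ev = Equivalence.from T-∨ (inj₂ (occurs-complete u v i eu ev))

covers-complete : ∀ {n} (u v : Vec Bool n) → (∀ x y → ∃ λ i → Vec.lookup u i ≡ x × Vec.lookup v i ≡ y) →
                  T (covers u v)
covers-complete u v patterns = both (found true true) (both (found true false) (both (found false true) (found false false)))
  where
  both : ∀ {a b} → T a → T b → T (a ∧ b)
  both ta tb = Equivalence.from T-∧ (ta , tb)
  found : ∀ x y → T (occurs u v x y)
  found x y = let (i , eu , ev) = patterns x y in occurs-complete u v i eu ev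

pairwise-from-unique : ∀ {A : Set} {P : A → Set} {R : A → A → Set} {xs} →
                       (∀ {u v} → P u → P v → u ≢ v → R u v) → All P xs → Unique xs → AllPairs R xs
pairwise-from-unique rel [] [] = []
pairwise-from-unique rel (pu ∷ ps) (u∉ ∷ unique) =
  All.zipWith (λ (pv , u≢v) → rel pu pv u≢v) (ps , u∉) ∷ pairwise-from-unique rel ps unique

three-or-four-flip : ∀ {a b} → a + b ≡ 7 → a ∈ 3 ∷ 4 ∷ [] → b ∈ 3 ∷ 4 ∷ []
three-or-four-flip {b = 4} refl (here refl) = there (here refl)
three-or-four-flip {b = 3} refl (there (here refl)) = here refl

ones-xor : ∀ h (f : Fin 7 → Bool) → ∑[ i < 7 ] χ (f i xor h) ∈ 3 ∷ 4 ∷ [] → ∑[ i < 7 ] χ (f i) ∈ 3 ∷ 4 ∷ []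
ones-xor false f w = subst (_∈ 3 ∷ 4 ∷ []) (sum-cong-≗ λ i → cong χ (xor-identityʳ (f i))) w
ones-xor true f w = three-or-four-flip
  (trans (+-comm (∑[ i < 7 ] χ (not (f i))) (∑[ i < 7 ] χ (f i))) (count-complement f))
  (subst (_∈ 3 ∷ 4 ∷ []) (sum-cong-≗ {7} λ i → cong χ (xor-true (f i))) w)
  where
  xor-true : ∀ x → x xor true ≡ not x
  xor-true false = refl
  xor-true true = refl

-- Complementing columns to start with false
-- gives 15 distinct, pairwise covering codes; listed in the order of `codes`
-- they form a clique considered by the search, hence a Good list.
module _ (M : Matrix 7 15) (ca : IsCoveringArray 2 7 15 M) where

  code : Fin 15 → Code
  code d = Vec.tabulate (λ i → M i d xor M zero d)

  lookup-code : ∀ d i → Vec.lookup (code d) i ≡ M i d xor M zero d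
  lookup-code d = lookup∘tabulate (λ i → M i d xor M zero d)

  code∈codes : ∀ d → code d ∈ codes
  code∈codes d = subst (_∈ codes) (cong (_∷ rest) (sym (xor-same (M zero d)))) (∈-map⁺ (false ∷_) (∈-vecs rest))
    where
    rest : Vec Bool 6
    rest = Vec.tabulate (λ i → M (suc i) d xor M zero d)

  code-patterns : ∀ {d₁ d₂} → d₁ ≢ d₂ → ∀ x y →
                  ∃ λ i → Vec.lookup (code d₁) i ≡ x × Vec.lookup (code d₂) i ≡ y
  code-patterns {d₁} {d₂} d₁≢d₂ x y =
    let (i , e₁ , e₂) = covered-pair M ca d₁≢d₂ (x xor M zero d₁) (y xor M zero d₂)
    in i , uncomplement d₁ x e₁ , uncomplement d₂ y e₂
    where
    uncomplement : ∀ {i} d z → M i d ≡ z xor M zero d → Vec.lookup (code d) i ≡ z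
    uncomplement {i} d z eq = trans (lookup-code d i) (trans (cong (_xor M zero d) eq) (xor-cancelʳ z (M zero d)))

  code-injective : ∀ {d₁ d₂} → code d₁ ≡ code d₂ → d₁ ≡ d₂
  code-injective {d₁} {d₂} same with d₁ Fin.≟ d₂
  ... | yes d₁≡d₂ = d₁≡d₂
  ... | no d₁≢d₂ with code-patterns d₁≢d₂ true false
  ... | i , is-true , is-false with trans (sym is-true) (subst (λ u → Vec.lookup u i ≡ false) (sym same) is-false)
  ... | ()

  in-image? : (u : Code) → Dec (∃ λ d → u ≡ code d)
  in-image? u = any? λ d → ≡-dec Bool._≟_ u (code d)

  clique : List Code
  clique = filter in-image? codes

  clique↭codes : clique ↭ tabulate code
  clique↭codes = ∼bag⇒↭ (unique∧set⇒bag (Unique.filter⁺ in-image? codes-unique)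
                                         (Unique.tabulate⁺ code-injective) (mk⇔ to from))
    where
    to : ∀ {u} → u ∈ clique → u ∈ tabulate code
    to u∈ = let (d , u≡) = proj₂ (∈-filter⁻ in-image? {xs = codes} u∈)
            in subst (_∈ tabulate code) (sym u≡) (∈-tabulate⁺ {f = code} d)
    from : ∀ {u} → u ∈ tabulate code → u ∈ clique
    from u∈ = let (d , u≡) = ∈-tabulate⁻ {f = code} u∈
              in ∈-filter⁺ in-image? (subst (_∈ codes) (sym u≡) (code∈codes d)) (d , u≡)

  clique-good : Good clique
  clique-good = search-sound 64 codes [] search-succeeds (filter-⊆ in-image? codes) covering
    (≤-reflexive (sym (trans (Perm.↭-length clique↭codes) (length-tabulate code))))
    where
    covering : Covering clique
    covering = pairwise-from-unique
      (λ { (d₁ , refl) (d₂ , refl) ne → covers-complete (code d₁) (code d₂) (code-patterns (ne ∘ cong code)) })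
      (all-filter in-image? codes) (Unique.filter⁺ in-image? codes-unique)

  tight : Tight M
  tight .Tight.column-weight d =
    ones-xor (M zero d) (λ i → M i d)
      (subst (_∈ 3 ∷ 4 ∷ []) (sum-cong-≗ λ i → cong χ (lookup-code d i))
        (All.lookup (proj₁ clique-good) (∈-filter⁺ in-image? (code∈codes d) (d , refl))))
  tight .Tight.row-distance i j i≢j = subst (_∈ 8 ∷ 10 ∷ []) distance-eq (proj₂ clique-good i j i≢j)
    where
    open ≡-Reasoning
    distance-eq : distance-in clique i j ≡ distance M i j
    distance-eq = begin
      distance-in clique i j          ≡⟨ sum-↭ (Perm.map⁺ _ clique↭codes) ⟩
      distance-in (tabulate code) i j ≡⟨ listSum-tabulate (λ u → χ (Vec.lookup u i xor Vec.lookup u j)) code ⟩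
      ∑[ d < 15 ] χ (Vec.lookup (code d) i xor Vec.lookup (code d) j)
        ≡⟨ sum-cong-≗ (λ d → cong χ (trans (cong₂ _xor_ (lookup-code d i) (lookup-code d j))
                                          (xor-cancel-both (M i d) (M j d) (M zero d)))) ⟩
      distance M i j ∎

-- CAN(2,15,2) ≥ 7: fewer rows could be padded to 7 rows, two of which would
-- coincide, whereas distinct rows of a Tight array differ somewhere.
at-least-7 : ∀ {k} (M : Matrix k 15) → IsCoveringArray 2 k 15 M → 7 ≤ k
at-least-7 {k} M ca with 7 ≤? k
... | yes 7≤k = 7≤k
... | no 7≰k with pad M (s≤s (s≤s z≤n)) (<⇒≤ (≰⇒> 7≰k)) ca
... | s , ca₇ with pigeonhole (≰⇒> 7≰k) s
... | i , j , i<j , same = ⊥-elim (not-8-or-10 (subst (_∈ 8 ∷ 10 ∷ []) no-difference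
                                         (Tight.row-distance (tight (λ r → M (s r)) ca₇) i j (Fin.<⇒≢ i<j))))
  where
  no-difference : distance (λ r → M (s r)) i j ≡ 0
  no-difference = sum-cong-≗ {15} λ d → cong χ (trans (cong (λ r → M (s i) d xor M r d) (sym same)) (xor-same (M (s i) d)))
  not-8-or-10 : ¬ (0 ∈ 8 ∷ 10 ∷ [])
  not-8-or-10 (here ())
  not-8-or-10 (there (here ()))
  not-8-or-10 (there (there ()))

tight-of-at-most-7 : ∀ {k} (M : Matrix k 15) → IsCoveringArray 2 k 15 M → k ≤ 7 → k ≡ 7 × Tight M
tight-of-at-most-7 M ca k≤7 with ≤-antisym k≤7 (at-least-7 M ca)
... | refl = refl , tight M ca

at-most-half : ∀ {a b} → a + b ≡ 14 → 7 ≤ b → a ≤ 7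
at-most-half {a} {b} a+b≡14 7≤b = +-cancelʳ-≤ b a 7 (≤-trans (≤-reflexive a+b≡14) (+-monoʳ-≤ 7 7≤b))

squares-25 : ∀ {a b} → a ∈ 3 ∷ 4 ∷ [] → a + b ≡ 7 → a * a + b * b ≡ 25
squares-25 (here refl) 3+b≡7 rewrite +-cancelˡ-≡ 3 _ 4 3+b≡7 = refl
squares-25 (there (here refl)) 4+b≡7 rewrite +-cancelˡ-≡ 4 _ 3 4+b≡7 = refl

-- (a − 6)(a − 8) ≥ 0 for every natural number a ≠ 7.
away-from-7 : ∀ a → a ≢ 7 → 14 * a ≤ a * a + 48
away-from-7 0 _ = z≤n
away-from-7 1 _ = ≤ᵇ⇒≤ 14 49 _
away-from-7 2 _ = ≤ᵇ⇒≤ 28 52 _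
away-from-7 3 _ = ≤ᵇ⇒≤ 42 57 _
away-from-7 4 _ = ≤ᵇ⇒≤ 56 64 _
away-from-7 5 _ = ≤ᵇ⇒≤ 70 73 _
away-from-7 6 _ = ≤ᵇ⇒≤ 84 84 _
away-from-7 7 a≢7 = ⊥-elim (a≢7 refl)
away-from-7 (suc (suc (suc (suc (suc (suc (suc (suc k)))))))) _ =
  subst (14 * (8 + k) ≤_) (sym (expand k)) (m≤m+n (14 * (8 + k)) ((2 + k) * k))
  where
  open +-*-Solver
  expand : ∀ k → (8 + k) * (8 + k) + 48 ≡ 14 * (8 + k) + (2 + k) * k
  expand = solve 1 (λ k → (con 8 :+ k) :* (con 8 :+ k) :+ con 48 := con 14 :* (con 8 :+ k) :+ (con 2 :+ k) :* k) refl

-- One agreeing column plus E agreements and D ∈ {8, 10} differences among 15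
-- further columns never make 7 agreements.
not-seven : ∀ {E D} → E + D ≡ 15 → D ∈ 8 ∷ 10 ∷ [] → suc E ≢ 7
not-seven {6} () (here refl) refl
not-seven {6} () (there (here refl)) refl

numbers-clash : ∀ S₁ S₂ D → S₁ ≡ 1568 → S₂ ≡ 13568 → D ≡ 14 →
                ¬ (14 * S₁ + 80 * D ≤ S₂ + ∑[ p < 14 ] ∑[ q < 14 ] 48)
numbers-clash _ _ _ refl refl refl = ≤⇒≤ᵇ

module _ (A : Matrix 14 16) (ca : IsCoveringArray 3 14 16 A) where

  value? : ∀ c b → Decidable (λ r → A r c ≡ b)
  value? c b r = A r c Bool.≟ b

  size : Fin 16 → Bool → ℕ
  size c b = length (members (value? c b))

  half : ∀ c b → Matrix (size c b) 15
  half c b i d = A (member (value? c b) i) (punchIn c d)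

  half-covering : ∀ c b → IsCoveringArray 2 (size c b) 15 (half c b)
  half-covering c b = derived A c b (member (value? c b)) (member-complete (value? c b)) ca

  count : Fin 16 → Bool → ℕ
  count c b = ∑[ r < 14 ] χ (agree (A r c) b)

  sizes-sum : ∀ c → size c true + size c false ≡ 14
  sizes-sum c = begin
    size c true + size c false     ≡⟨ cong₂ _+_ (members-count (value? c true)) (members-count (value? c false)) ⟩
    count c true + count c false   ≡⟨ cong (count c true +_) (sum-cong-≗ λ r → cong χ (false-is-not-true (A r c))) ⟩
    count c true + ∑[ r < 14 ] χ (not (agree (A r c) true)) ≡⟨ count-complement (λ r → agree (A r c) true) ⟩
    14 ∎
    where
    open ≡-Reasoning
    false-is-not-true : ∀ z → agree z false ≡ not (agree z true)
    false-is-not-true true = refl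
    false-is-not-true false = refl

  -- Both halves of a column have at least 7 of its 14 rows, so each half is a
  -- Tight CA(7;2,15,2) and every column is balanced.
  half-tight : ∀ c b → size c b ≡ 7 × Tight (half c b)
  half-tight c b = tight-of-at-most-7 (half c b) (half-covering c b) (at-most b)
    where
    at-most : ∀ b → size c b ≤ 7
    at-most true = at-most-half (sizes-sum c) (at-least-7 (half c false) (half-covering c false))
    at-most false = at-most-half (trans (+-comm (size c false) (size c true)) (sizes-sum c))
                                 (at-least-7 (half c true) (half-covering c true))

  balanced : ∀ c b → count c b ≡ 7
  balanced c b = trans (sym (members-count (value? c b))) (proj₁ (half-tight c b))

  pair-count : Fin 16 → Fin 16 → Bool → Bool → ℕ
  pair-count c d x y = ∑[ r < 14 ] (χ (agree (A r c) x) * χ (agree (A r d) y))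

  pair-counts : ∀ c d′ x → let d = punchIn c d′ in
                pair-count c d x true ∈ 3 ∷ 4 ∷ [] × pair-count c d x true + pair-count c d x false ≡ 7
  pair-counts c d′ x = subst (_∈ 3 ∷ 4 ∷ []) (sym (in-half true)) (Tight.column-weight (proj₂ (half-tight c x)) d′) ,
    (begin
      pair-count c d x true + pair-count c d x false                       ≡⟨ cong₂ _+_ (in-half true) (in-half false) ⟩
      weight (half c x) d′ + ∑[ i < size c x ] χ (not (half c x i d′))    ≡⟨ count-complement (λ i → half c x i d′) ⟩
      size c x                                                             ≡⟨ proj₁ (half-tight c x) ⟩
      7 ∎)
    where
    open ≡-Reasoning
    d = punchIn c d′
    has-value : Bool → Bool → Bool
    has-value true z = z
    has-value false z = not z
    agree≡has-value : ∀ y z → agree z y ≡ has-value y z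
    agree≡has-value true true = refl
    agree≡has-value true false = refl
    agree≡has-value false true = refl
    agree≡has-value false false = refl
    in-half : ∀ y → pair-count c d x y ≡ ∑[ i < size c x ] χ (has-value y (half c x i d′))
    in-half y = trans (sym (members-sum (value? c x) (λ r → χ (agree (A r d) y))))
                      (sum-cong-≗ λ i → cong χ (agree≡has-value y (half c x i d′)))

  -- Two distinct rows agreeing in column c lie in the same Tight half, so they
  -- differ in 8 or 10 of the other 15 columns.
  differences : Fin 16 → Fin 14 → Fin 14 → ℕ
  differences c p q = ∑[ d′ < 15 ] χ (A p (punchIn c d′) xor A q (punchIn c d′))

  same-half-differences : ∀ c {p q} → p ≢ q → A p c ≡ A q c → differences c p q ∈ 8 ∷ 10 ∷ []
  same-half-differences c {p} {q} p≢q same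
    with member-complete (value? c (A p c)) p refl | member-complete (value? c (A p c)) q (sym same)
  ... | i , i↦p | j , j↦q =
    subst (_∈ 8 ∷ 10 ∷ []) (cong₂ (differences c) i↦p j↦q)
      (Tight.row-distance (proj₂ (half-tight c (A p c))) i j
        (λ i≡j → p≢q (trans (sym i↦p) (trans (cong (member (value? c (A p c))) i≡j) j↦q))))

  agree-pairs : Fin 16 → ℕ
  agree-pairs c = ∑[ p < 14 ] ∑[ q < 14 ] χ (agree (A p c) (A q c))

  agree-pairs² : Fin 16 → Fin 16 → ℕ
  agree-pairs² c d = ∑[ p < 14 ] ∑[ q < 14 ] (χ (agree (A p c) (A q c)) * χ (agree (A p d) (A q d)))

  -- A balanced column has 7² + 7² agreeing ordered pairs.
  agree-pairs≡98 : ∀ c → agree-pairs c ≡ 98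
  agree-pairs≡98 c = begin
    agree-pairs c
      ≡⟨ sum-cong-≗ (λ p → sum-cong-≗ λ q → agree-by-value (A p c) (A q c)) ⟩
    ∑[ p < 14 ] ∑[ q < 14 ] ∑𝔹 (λ x → χ (agree (A p c) x) * χ (agree (A q c) x))
      ≡⟨ pairs-by-value (λ p x → χ (agree (A p c) x)) ⟩
    ∑𝔹 (λ x → count c x * count c x)
      ≡⟨ cong₂ _+_ (cong₂ _*_ (balanced c true) (balanced c true)) (cong₂ _*_ (balanced c false) (balanced c false)) ⟩
    98 ∎
    where open ≡-Reasoning

  agree-pairs²-diagonal : ∀ c → agree-pairs² c c ≡ 98
  agree-pairs²-diagonal c = trans (sum-cong-≗ λ p → sum-cong-≗ λ q → idempotent (agree (A p c) (A q c)))
                                  (agree-pairs≡98 c)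
    where
    idempotent : ∀ b → χ b * χ b ≡ χ b
    idempotent true = refl
    idempotent false = refl

  -- With pair counts 3 and 4, two distinct columns have 2 · (3² + 4²) doubly agreeing pairs.
  agree-pairs²-off-diagonal : ∀ c d′ → agree-pairs² c (punchIn c d′) ≡ 50
  agree-pairs²-off-diagonal c d′ = begin
    agree-pairs² c d
      ≡⟨ sum-cong-≗ (λ p → sum-cong-≗ λ q → agree²-by-value (A p c) (A p d) (A q c) (A q d)) ⟩
    ∑[ p < 14 ] ∑[ q < 14 ] ∑𝔹 (λ x → ∑𝔹 λ y → w p x y * w q x y)
      ≡⟨ pairs-by-value² w ⟩
    ∑𝔹 (λ x → ∑𝔹 λ y → pair-count c d x y * pair-count c d x y)
      ≡⟨ cong₂ _+_ (split true) (split false) ⟩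
    50 ∎
    where
    open ≡-Reasoning
    d = punchIn c d′
    w : Fin 14 → Bool → Bool → ℕ
    w p x y = χ (agree (A p c) x) * χ (agree (A p d) y)
    split : ∀ x → ∑𝔹 (λ y → pair-count c d x y * pair-count c d x y) ≡ 25
    split x = let (three-or-four , total) = pair-counts c d′ x in squares-25 three-or-four total

  agreements : Fin 14 → Fin 14 → ℕ
  agreements p q = ∑[ c < 16 ] χ (agree (A p c) (A q c))

  agreements-sum : ∑[ p < 14 ] ∑[ q < 14 ] agreements p q ≡ 1568
  agreements-sum = trans (∑∑∑-swap (λ p q c → χ (agree (A p c) (A q c)))) (sum-cong-≗ agree-pairs≡98)

  agreements-square-sum : ∑[ p < 14 ] ∑[ q < 14 ] (agreements p q * agreements p q) ≡ 13568
  agreements-square-sum = begin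
    ∑[ p < 14 ] ∑[ q < 14 ] (agreements p q * agreements p q)
      ≡⟨ sum-cong-≗ (λ p → sum-cong-≗ λ q → ∑-square (λ c → χ (agree (A p c) (A q c)))) ⟩
    ∑[ p < 14 ] ∑[ q < 14 ] ∑[ c < 16 ] ∑[ d < 16 ] (χ (agree (A p c) (A q c)) * χ (agree (A p d) (A q d)))
      ≡⟨ ∑∑∑∑-swap (λ p q c d → χ (agree (A p c) (A q c)) * χ (agree (A p d) (A q d))) ⟩
    ∑[ c < 16 ] ∑[ d < 16 ] agree-pairs² c d
      ≡⟨ sum-cong-≗ (λ c → sum-remove {i = c} (agree-pairs² c)) ⟩
    ∑[ c < 16 ] (agree-pairs² c c + ∑[ d′ < 15 ] agree-pairs² c (punchIn c d′))
      ≡⟨ sum-cong-≗ (λ c → cong₂ _+_ (agree-pairs²-diagonal c) (sum-cong-≗ (agree-pairs²-off-diagonal c))) ⟩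
    13568 ∎
    where open ≡-Reasoning

  agreements-self : ∀ p → agreements p p ≡ 16
  agreements-self p = sum-cong-≗ λ c → cong χ (dec-true (A p c Bool.≟ A p c) refl)

  agreements-besides : Fin 16 → Fin 14 → Fin 14 → ℕ
  agreements-besides c p q = ∑[ d′ < 15 ] χ (agree (A p (punchIn c d′)) (A q (punchIn c d′)))

  agreements-split : ∀ c p q → agreements p q ≡ χ (agree (A p c) (A q c)) + agreements-besides c p q
  agreements-split c p q = sum-remove {i = c} (λ c′ → χ (agree (A p c′) (A q c′)))

  besides-total : ∀ c p q → agreements-besides c p q + differences c p q ≡ 15
  besides-total c p q = begin
    agreements-besides c p q + differences c p q
      ≡⟨ +-comm (agreements-besides c p q) (differences c p q) ⟩
    differences c p q + agreements-besides c p q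
      ≡⟨ cong (differences c p q +_)
              (sum-cong-≗ λ d′ → cong χ (agree≡not-xor (A p (punchIn c d′)) (A q (punchIn c d′)))) ⟩
    differences c p q + ∑[ d′ < 15 ] χ (not (A p (punchIn c d′) xor A q (punchIn c d′)))
      ≡⟨ count-complement (λ d′ → A p (punchIn c d′) xor A q (punchIn c d′)) ⟩
    15 ∎
    where open ≡-Reasoning

  agreements≢7 : ∀ p q → p ≢ q → agreements p q ≢ 7
  agreements≢7 p q p≢q seven =
    let (c , agree-c) = count-witness (λ c → agree (A p c) (A q c)) (subst (0 <_) (sym seven) (s≤s z≤n))
    in not-seven (besides-total c p q) (same-half-differences c p≢q (agree-sound agree-c))
         (trans (cong (λ b → χ b + agreements-besides c p q) (sym (Equivalence.to T-≡ agree-c)))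
                (trans (sym (agreements-split c p q)) seven))

  -- Summing 14a + 80·[p = q] ≤ a² + 48 over all pairs of rows — this is
  -- (a − 6)(a − 8) ≥ 0 off the diagonal and an equality on it — gives
  -- 23072 ≤ 22976.
  no-array : ⊥
  no-array = numbers-clash (∑[ p < 14 ] ∑[ q < 14 ] agreements p q)
                           (∑[ p < 14 ] ∑[ q < 14 ] (agreements p q * agreements p q))
                           (∑[ p < 14 ] ∑[ q < 14 ] diagonal p q)
                           agreements-sum agreements-square-sum diagonal-total
                           (subst₂ _≤_ left right (∑-mono λ p → ∑-mono λ q → pointwise p q))
    where
    -- Opaque so that the closed diagonal sums are not evaluated during unification.
    opaque
      diagonal : Fin 14 → Fin 14 → ℕ
      diagonal p q = χ (does (p Fin.≟ q))

      diagonal-total : ∑[ p < 14 ] ∑[ q < 14 ] diagonal p q ≡ 14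
      diagonal-total = sum-cong-≗ λ p → begin
        ∑[ q < 14 ] diagonal p q                               ≡⟨ sum-remove {i = p} (diagonal p) ⟩
        diagonal p p + ∑[ q′ < 13 ] diagonal p (punchIn p q′)
          ≡⟨ cong₂ _+_ (cong χ (dec-true (p Fin.≟ p) refl))
                       (sum-cong-≗ λ q′ → cong χ (dec-false (p Fin.≟ punchIn p q′) (punchInᵢ≢i p q′ ∘ sym))) ⟩
        1 ∎
        where open ≡-Reasoning

      pointwise : ∀ p q → 14 * agreements p q + 80 * diagonal p q ≤ agreements p q * agreements p q + 48
      pointwise p q with p Fin.≟ q
      ... | yes refl rewrite agreements-self p = ≤-refl
      ... | no p≢q rewrite +-identityʳ (14 * agreements p q) = away-from-7 (agreements p q) (agreements≢7 p q p≢q)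

    left : ∑[ p < 14 ] ∑[ q < 14 ] (14 * agreements p q + 80 * diagonal p q) ≡
           14 * ∑[ p < 14 ] ∑[ q < 14 ] agreements p q + 80 * ∑[ p < 14 ] ∑[ q < 14 ] diagonal p q
    left = trans (∑∑-+ (λ p q → 14 * agreements p q) (λ p q → 80 * diagonal p q))
                 (cong₂ _+_ (∑∑-* 14 agreements) (∑∑-* 80 diagonal))

    right : ∑[ p < 14 ] ∑[ q < 14 ] (agreements p q * agreements p q + 48) ≡
            ∑[ p < 14 ] ∑[ q < 14 ] (agreements p q * agreements p q) + ∑[ p < 14 ] ∑[ q < 14 ] 48
    right = ∑∑-+ (λ p q → agreements p q * agreements p q) (λ _ _ → 48)

lemma4p5 : (m : ℕ) → m ≤ 14 → (A : Matrix m 16) → ¬ IsCoveringArray 3 m 16 A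
lemma4p5 m m≤14 A ca = let (s , ca₁₄) = pad A (s≤s (s≤s (s≤s z≤n))) m≤14 ca in no-array (λ i → A (s i)) ca₁₄
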